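{- Let $q$ be a prime power, $n\ge 2$, and let $m_1,\dots,m_{n-1}\in\mathbb{N}_0$ satisfy $\sum_{i=1}^{n-1} m_i q^{i-1}=q^{n-1}$. Then there exists an affine vector space partition of $\mathrm{PG}(n-1,q)$ of type $(n-1)^{m_{n-1}}\cdots 2^{m_2}1^{m_1}$, i.e. one having exactly $m_i$ elements of dimension $i$ for each $1\le i\le n-1$.
   Context: $\mathrm{PG}(n-1,q)$ denotes the projective geometry of $\mathbb{F}_q^n$; all dimensions are algebraic (vector space) dimensions, so points are $1$-dimensional subspaces and hyperplanes are $(n-1)$-dimensional subspaces. An affine vector space partition of $\mathrm{PG}(n-1,q)$ is a set $\mathcal{U}=\{U_1,\dots,U_r\}$ of subspaces with $1\le \dim U_i\le n-1$ for which there exists a hyperplane $H_\infty$ such that no $U_i$ is contained in $H_\infty$ and every point not contained in $H_\infty$ is contained in exactly one $U_i$. -}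

module Defs where

open import Level using (0ℓ)
open import Data.Nat using (ℕ; zero; suc; _^_; _≤_; _∸_)
open import Data.Nat.Primality using (Prime)
open import Data.Fin using (Fin; toℕ) renaming (zero to fzero; suc to fsuc)
open import Data.Bool using (Bool; true; false)
open import Data.List using (List; length; filter)
open import Data.Product using (Σ; ∃; ∃-syntax; _×_; _,_)
open import Relation.Nullary using (¬_)
open import Relation.Binary.PropositionalEquality as ≡ using (_≡_)
open import Algebra.Bundles using (CommutativeRing)
open import Function.Bundles using (Bijection)
open import Data.List using (allFin)
import Data.Nat as ℕ

IsPrimePower : ℕ → Set
IsPrimePower q = ∃[ p ] ∃[ k ] (Prime p × q ≡ p ^ suc k)

record Field : Set₁ where
  field
    commRing : CommutativeRing 0ℓ 0ℓ
  open CommutativeRing commRing public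
  field
    nontrivial : ¬ (1# ≈ 0#)
    inverse    : ∀ x → ¬ (x ≈ 0#) → ∃[ y ] (x * y ≈ 1#)

record FiniteField (q : ℕ) : Set₁ where
  field
    fld : Field
  open Field fld public
  field
    card : Bijection setoid (≡.setoid (Fin q))

sumℕ : ∀ {n} → (Fin n → ℕ) → ℕ
sumℕ {zero}  f = 0
sumℕ {suc n} f = f fzero ℕ.+ sumℕ (λ i → f (fsuc i))

countDim : ∀ {r} → (Fin r → ℕ) → ℕ → ℕ
countDim {r} d t = length (filter (λ k → d k ℕ.≟ t) (allFin r))

module LinAlg (F : Field) where
  open Field F

  ∑ : ∀ {n} → (Fin n → Carrier) → Carrier
  ∑ {zero}  f = 0#
  ∑ {suc n} f = f fzero + ∑ (λ i → f (fsuc i))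

  Vect : ℕ → Set
  Vect n = Fin n → Carrier

  lincomb : ∀ {n d} → (Fin d → Carrier) → (Fin d → Vect n) → Vect n
  lincomb c b k = ∑ (λ j → c j * b j k)

  LinearlyIndependent : ∀ {n d} → (Fin d → Vect n) → Set
  LinearlyIndependent b = ∀ c → (∀ k → lincomb c b k ≈ 0#) → ∀ j → c j ≈ 0#

  record Subspace (n : ℕ) : Set where
    field
      dim   : ℕ
      basis : Fin dim → Vect n
      indep : LinearlyIndependent basis

  _∈ₛ_ : ∀ {n} → Vect n → Subspace n → Set
  v ∈ₛ U = ∃[ c ] (∀ k → v k ≈ lincomb c (Subspace.basis U) k)

  _·_ : ∀ {n} → Vect n → Vect n → Carrier
  a · v = ∑ (λ k → a k * v k)

  record Hyperplane (n : ℕ) : Set where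
    field
      normal  : Vect n
      nonzero : ∃[ k ] ¬ (normal k ≈ 0#)

  _∈ₕ_ : ∀ {n} → Vect n → Hyperplane n → Set
  v ∈ₕ H = Hyperplane.normal H · v ≈ 0#

  _⊆ₕ_ : ∀ {n} → Subspace n → Hyperplane n → Set
  U ⊆ₕ H = ∀ v → v ∈ₛ U → v ∈ₕ H

  -- An affine vector space partition of PG(n-1,F): a family U_0..U_{r-1} of subspaces
  -- with 1 ≤ dim ≤ n-1 and a hyperplane H∞ such that no U_i ⊆ H∞ and every vector
  -- (equivalently point) outside H∞ lies in exactly one U_i.
  record AffineVSP (n : ℕ) : Set where
    field
      r       : ℕ
      U       : Fin r → Subspace n
      dim-pos : ∀ i → 1 ≤ Subspace.dim (U i)
      dim-le  : ∀ i → Subspace.dim (U i) ≤ n ∸ 1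
      H∞      : Hyperplane n
      notIn   : ∀ i → ¬ (U i ⊆ₕ H∞)
      cover   : ∀ v → ¬ (v ∈ₕ H∞) → ∃[ i ] (v ∈ₛ U i × (∀ j → v ∈ₛ U j → j ≡ i))

    count : ℕ → ℕ
    count t = countDim (λ i → Subspace.dim (U i)) t

module Submission where

open import Defs
open import Data.Nat using (ℕ; suc; _*_; _^_; _≤_; _∸_)
open import Data.Fin using (Fin; toℕ)
open import Data.Product using (Σ; ∃; ∃-syntax; _×_; _,_)
open import Relation.Binary.PropositionalEquality using (_≡_)

open import Level using (0ℓ)
open import Data.Bool using (true; false)
open import Data.Empty using (⊥-elim)
open import Data.Nat as ℕ using (zero; _+_; _<_; z≤n; s≤s; NonZero; _≤?_)
open import Data.Nat.Properties as ℕ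
  using (+-cancelˡ-≡; +-cancelʳ-≡; m*n≡0⇒m≡0; m^n≢0; m+n≡0⇒m≡0; m+n≡0⇒n≡0; m≤n⇒∃[o]m+o≡n; ≰⇒>)
open import Data.Nat.Tactic.RingSolver using (solve-∀)
open import Data.Fin as Fin using (cast; splitAt; join; opposite) renaming (zero to fzero; suc to fsuc)
import Data.Fin.Properties as Fin
import Data.Fin.Permutation as Perm
open import Data.Vec.Functional using (tail; reverse) renaming (_∷_ to _∷ᵛ_)
open import Data.Product using (∃₂; Σ-syntax; proj₁; proj₂)
open import Data.Sum using (_⊎_; inj₁; inj₂; [_,_]′)
open import Data.List as List using (List; []; _∷_; _++_; length; filter; map; concat; tabulate; allFin)
import Data.List.Properties as List
open import Data.List.Relation.Unary.All as All using (All; []; _∷_)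
import Data.List.Relation.Unary.All.Properties as All
open import Data.List.Membership.Propositional using (lose)
open import Data.List.Membership.Propositional.Properties using (∈-lookup)
open import Relation.Nullary using (¬_; yes; no; does)
open import Relation.Unary using (Pred; ∁; _≐_; Decidable)
open import Relation.Binary.PropositionalEquality as ≡
  using (_≢_; refl; sym; trans; cong; cong₂; subst; module ≡-Reasoning)
open import Function using (_∘_; id)
open import Function.Bundles using (Bijection; Inverse; _⇔_; mk⇔; Equivalence)
open import Function.Properties.Bijection using (Bijection⇒Inverse)
open import Function.Properties.Equivalence using () renaming (trans to ⇔-trans)
import Algebra.Properties.CommutativeMonoid.Sum as CommutativeMonoidSum

-- Normalising v₀ = 1, the points of PG(n-1,q) off the hyperplane x₀ = 0 are the words of
-- length N = n - 1 over an alphabet of q letters.  Fixing the first c letters to a word w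
-- gives the subspace spanned by (1, w, 0, …, 0) and the last N - c unit vectors; it has
-- dimension N - c + 1 and its affine points are exactly the words beginning with w.  Hence
-- a complete prefix code with m_i codewords of length n - i yields the partition, and the
-- hypothesis Σ m_i q^(i-1) = q^(n-1) is precisely Kraft's equality for these lengths.
-- Kraft's equality suffices: if there is no empty codeword, the length profile splits
-- greedily into q profiles that satisfy Kraft's equality one level down, and the q codes
-- built recursively are prefixed with the q letters.

data ExactlyOne {A : Set} (P : Pred A 0ℓ) : List A → Set where
  here  : ∀ {x xs} → P x → All (∁ P) xs → ExactlyOne P (x ∷ xs)
  there : ∀ {x xs} → ¬ P x → ExactlyOne P xs → ExactlyOne P (x ∷ xs)

module _ {A : Set} {P : Pred A 0ℓ} where

  ExactlyOne⇒∃!-index : ∀ {xs} → ExactlyOne P xs →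
    ∃[ i ] (P (List.lookup xs i) × (∀ j → P (List.lookup xs j) → j ≡ i))
  ExactlyOne⇒∃!-index (here px none) = fzero , px , λ
    { fzero    _  → refl
    ; (fsuc j) pj → ⊥-elim (All.lookup none (∈-lookup j) pj) }
  ExactlyOne⇒∃!-index (there ¬px one) with ExactlyOne⇒∃!-index one
  ... | i , pi , unique = fsuc i , pi , λ
    { fzero    p  → ⊥-elim (¬px p)
    ; (fsuc j) pj → cong fsuc (unique j pj) }

  ExactlyOne-resp : ∀ {Q : Pred A 0ℓ} {xs} → P ≐ Q → ExactlyOne P xs → ExactlyOne Q xs
  ExactlyOne-resp (P⊆Q , Q⊆P) (here px none)  = here (P⊆Q px) (All.map (_∘ Q⊆P) none)
  ExactlyOne-resp P≐Q@(_ , Q⊆P) (there ¬px one) = there (¬px ∘ Q⊆P) (ExactlyOne-resp P≐Q one)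

  ExactlyOne-map⁺ : ∀ {B : Set} {f : B → A} {xs} → ExactlyOne (P ∘ f) xs → ExactlyOne P (map f xs)
  ExactlyOne-map⁺ (here px none)  = here px (All.map⁺ none)
  ExactlyOne-map⁺ (there ¬px one) = there ¬px (ExactlyOne-map⁺ one)

  ExactlyOne-++ˡ : ∀ {xs ys} → ExactlyOne P xs → All (∁ P) ys → ExactlyOne P (xs ++ ys)
  ExactlyOne-++ˡ (here px none)  none′ = here px (All.++⁺ none none′)
  ExactlyOne-++ˡ (there ¬px one) none′ = there ¬px (ExactlyOne-++ˡ one none′)

  ExactlyOne-++ʳ : ∀ {xs ys} → All (∁ P) xs → ExactlyOne P ys → ExactlyOne P (xs ++ ys)
  ExactlyOne-++ʳ []           one = one
  ExactlyOne-++ʳ (¬px ∷ none) one = there ¬px (ExactlyOne-++ʳ none one)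

  ExactlyOne-concat-tabulate : ∀ {k} (F : Fin k → List A) a →
    ExactlyOne P (F a) → (∀ b → b ≢ a → All (∁ P) (F b)) → ExactlyOne P (concat (tabulate F))
  ExactlyOne-concat-tabulate {suc k} F fzero one none =
    ExactlyOne-++ˡ one (All.concat⁺ (All.tabulate⁺ (λ b → none (fsuc b) (λ ()))))
  ExactlyOne-concat-tabulate {suc k} F (fsuc a) one none =
    ExactlyOne-++ʳ (none fzero (λ ()))
      (ExactlyOne-concat-tabulate (F ∘ fsuc) a one (λ b b≢a → none (fsuc b) (b≢a ∘ Fin.suc-injective)))

length-filter-map : ∀ {A B : Set} {P : Pred B 0ℓ} (P? : Decidable P) (f : A → B) xs →
  length (filter P? (map f xs)) ≡ length (filter (P? ∘ f) xs)
length-filter-map P? f []       = refl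
length-filter-map P? f (x ∷ xs) with does (P? (f x))
... | true  = cong suc (length-filter-map P? f xs)
... | false = length-filter-map P? f xs

length-filter≡0⇒ : ∀ {A : Set} {P : Pred A 0ℓ} (P? : Decidable P) xs →
  length (filter P? xs) ≡ 0 → ∀ i → ¬ P (List.lookup xs i)
length-filter≡0⇒ P? xs none i p =
  ℕ.<-irrefl refl (subst (0 <_) none (List.filter-some P? {xs} (lose (∈-lookup i) p)))

map-lookup-allFin : ∀ {A : Set} (xs : List A) → map (List.lookup xs) (allFin (length xs)) ≡ xs
map-lookup-allFin xs = trans (List.map-tabulate id (List.lookup xs)) (List.tabulate-lookup xs)

open CommutativeMonoidSum ℕ.+-0-commutativeMonoid using (sum; ∑-distrib-+; sum-permute)

sumℕ≡sum : ∀ {k} (f : Fin k → ℕ) → sumℕ f ≡ sum f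
sumℕ≡sum {zero}  f = refl
sumℕ≡sum {suc k} f = cong (f fzero +_) (sumℕ≡sum (tail f))

sumℕ-cong : ∀ {k} {f g : Fin k → ℕ} → (∀ i → f i ≡ g i) → sumℕ f ≡ sumℕ g
sumℕ-cong {zero}  f≗g = refl
sumℕ-cong {suc k} f≗g = cong₂ _+_ (f≗g fzero) (sumℕ-cong (f≗g ∘ fsuc))

sumℕ-zeros : ∀ k → sumℕ {k} (λ _ → 0) ≡ 0
sumℕ-zeros zero    = refl
sumℕ-zeros (suc k) = sumℕ-zeros k

sumℕ≡0⇒ : ∀ {k} (f : Fin k → ℕ) → sumℕ f ≡ 0 → ∀ i → f i ≡ 0
sumℕ≡0⇒ f Σ≡0 fzero    = m+n≡0⇒m≡0 (f fzero) Σ≡0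
sumℕ≡0⇒ f Σ≡0 (fsuc i) = sumℕ≡0⇒ (tail f) (m+n≡0⇒n≡0 (f fzero) Σ≡0) i

sumℕ-+ : ∀ {k} (f g : Fin k → ℕ) → sumℕ (λ i → f i + g i) ≡ sumℕ f + sumℕ g
sumℕ-+ f g = begin
  sumℕ (λ i → f i + g i) ≡⟨ sumℕ≡sum (λ i → f i + g i) ⟩
  sum (λ i → f i + g i)  ≡⟨ ∑-distrib-+ f g ⟩
  sum f + sum g          ≡⟨ sym (cong₂ _+_ (sumℕ≡sum f) (sumℕ≡sum g)) ⟩
  sumℕ f + sumℕ g        ∎
  where open ≡-Reasoning

sumℕ-reverse : ∀ {k} (f : Fin k → ℕ) → sumℕ (reverse f) ≡ sumℕ f
sumℕ-reverse f = begin
  sumℕ (reverse f) ≡⟨ sumℕ≡sum (reverse f) ⟩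
  sum (reverse f)  ≡⟨ sym (sum-permute f Perm.reverse) ⟩
  sum f            ≡⟨ sym (sumℕ≡sum f) ⟩
  sumℕ f           ∎
  where open ≡-Reasoning

m*n+o≡n⇒m≡1∧o≡0 : ∀ m {n o} .⦃ _ : NonZero n ⦄ → m ≢ 0 → m * n + o ≡ n → m ≡ 1 × o ≡ 0
m*n+o≡n⇒m≡1∧o≡0 zero    m≢0 _ = ⊥-elim (m≢0 refl)
m*n+o≡n⇒m≡1∧o≡0 (suc m) {n} {o} _ eq =
  cong suc (m*n≡0⇒m≡0 m n (m+n≡0⇒m≡0 (m * n) mn+o≡0)) , m+n≡0⇒n≡0 (m * n) mn+o≡0
  where
  mn+o≡0 : m * n + o ≡ 0
  mn+o≡0 = +-cancelˡ-≡ n _ 0 (trans (sym (ℕ.+-assoc n (m * n) o)) (trans eq (sym (ℕ.+-identityʳ n))))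

-- Prefix codes and Kraft's equality

module PrefixCodes (q : ℕ) where

  record Cylinder (K : ℕ) : Set where
    field
      fixed free : ℕ
      fixed+free : fixed + free ≡ K
      word       : Fin fixed → Fin q

  open Cylinder public

  -- The positions of a word of length K split into the fixed ones, which come first, and the free ones.
  module _ {K} (C : Cylinder K) where

    position : Fin (fixed C) ⊎ Fin (free C) → Fin K
    position = cast (fixed+free C) ∘ join (fixed C) (free C)

    coordinate : Fin K → Fin (fixed C) ⊎ Fin (free C)
    coordinate = splitAt (fixed C) ∘ cast (sym (fixed+free C))

    coordinate-position : ∀ x → coordinate (position x) ≡ x
    coordinate-position x =
      trans (cong (splitAt (fixed C)) (Fin.cast-involutive (sym (fixed+free C)) (fixed+free C) _))
            (Fin.splitAt-join (fixed C) (free C) x)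

    position-coordinate : ∀ t → position (coordinate t) ≡ t
    position-coordinate t =
      trans (cong (cast _) (Fin.join-splitAt (fixed C) (free C) _))
            (Fin.cast-involutive (fixed+free C) (sym (fixed+free C)) t)

  _∈ᶜ_ : ∀ {K} → (Fin K → Fin q) → Cylinder K → Set
  d ∈ᶜ C = ∀ i → d (position C (inj₁ i)) ≡ word C i

  whole : ∀ {K} → Cylinder K
  whole {K} = record { fixed = 0 ; free = K ; fixed+free = refl ; word = λ () }

  lift : ∀ {K} → Fin q → Cylinder K → Cylinder (suc K)
  lift a C = record
    { fixed = suc (fixed C) ; free = free C ; fixed+free = cong suc (fixed+free C) ; word = a ∷ᵛ word C }

  ∈-lift⁻ : ∀ {K} {d : Fin (suc K) → Fin q} {a C} → d ∈ᶜ lift a C → d fzero ≡ a × tail d ∈ᶜ C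
  ∈-lift⁻ d∈ = d∈ fzero , d∈ ∘ fsuc

  ∈-lift⁺ : ∀ {K} {d : Fin (suc K) → Fin q} {a C} → d fzero ≡ a → tail d ∈ᶜ C → d ∈ᶜ lift a C
  ∈-lift⁺ d₀≡a d∈ fzero    = d₀≡a
  ∈-lift⁺ d₀≡a d∈ (fsuc i) = d∈ i

  depthCount : ∀ {K} → List (Cylinder K) → ℕ → ℕ
  depthCount L c = length (filter (λ C → fixed C ℕ.≟ c) L)

  depthCount-++ : ∀ {K} (L L′ : List (Cylinder K)) c →
    depthCount (L ++ L′) c ≡ depthCount L c + depthCount L′ c
  depthCount-++ L L′ c =
    trans (cong length (List.filter-++ (λ C → fixed C ℕ.≟ c) L L′)) (List.length-++ (filter _ L))

  depthCount-concat : ∀ {K k} (F : Fin k → List (Cylinder K)) c →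
    depthCount (concat (tabulate F)) c ≡ sumℕ (λ a → depthCount (F a) c)
  depthCount-concat {k = zero}  F c = refl
  depthCount-concat {k = suc k} F c =
    trans (depthCount-++ (F fzero) _ c) (cong (depthCount (F fzero) c +_) (depthCount-concat (F ∘ fsuc) c))

  depthCount-lift : ∀ {K} a (L : List (Cylinder K)) c → depthCount (map (lift a) L) (suc c) ≡ depthCount L c
  depthCount-lift a L c = trans (length-filter-map _ (lift a) L)
    (cong length (List.filter-≐ _ _ (ℕ.suc-injective , cong suc) L))

  dimensionCount : ∀ {K} → List (Cylinder K) → ℕ → ℕ
  dimensionCount L t = length (filter (λ C → suc (free C) ℕ.≟ t) L)

  dimensionCount≡depthCount : ∀ {N} (L : List (Cylinder (suc N))) (j : Fin (suc N)) →
    dimensionCount L (suc (toℕ j)) ≡ depthCount L (suc (toℕ (opposite j)))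
  dimensionCount≡depthCount {N} L j =
    cong length (List.filter-≐ _ _ ((λ {C} → free⇒fixed {C}) , (λ {C} → fixed⇒free {C})) L)
    where
    sizes : suc (toℕ (opposite j)) + toℕ j ≡ suc N
    sizes = cong suc (trans (cong (_+ toℕ j) (Fin.opposite-prop j)) (ℕ.m∸n+n≡m (Fin.toℕ≤pred[n] j)))

    free⇒fixed : ∀ {C} → suc (free C) ≡ suc (toℕ j) → fixed C ≡ suc (toℕ (opposite j))
    free⇒fixed {C} refl = +-cancelʳ-≡ (toℕ j) _ _ (trans (fixed+free C) (sym sizes))

    fixed⇒free : ∀ {C} → fixed C ≡ suc (toℕ (opposite j)) → suc (free C) ≡ suc (toℕ j)
    fixed⇒free {C} refl = cong suc (+-cancelˡ-≡ (fixed C) _ _ (trans (fixed+free C) (sym sizes)))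

  -- n c is the number of codewords of length c, i.e. of cylinders with c fixed letters.
  Profile : ℕ → Set
  Profile K = Fin (suc K) → ℕ

  record PrefixCode (K : ℕ) (n : Profile K) : Set where
    field
      cylinders : List (Cylinder K)
      partition : ∀ d → ExactlyOne (d ∈ᶜ_) cylinders
      profile   : ∀ c → depthCount cylinders (toℕ c) ≡ n c

  open PrefixCode public

  trivialCode : ∀ {K} {n : Profile K} → n fzero ≡ 1 → (∀ c → n (fsuc c) ≡ 0) → PrefixCode K n
  trivialCode n₀≡1 n₊≡0 = record
    { cylinders = whole ∷ []
    ; partition = λ d → here (λ ()) []
    ; profile   = λ { fzero → sym n₀≡1 ; (fsuc c) → sym (n₊≡0 c) }
    }

  branch : ∀ {K} {n : Profile (suc K)} {P : Fin q → Profile K} →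
    n fzero ≡ 0 → (∀ c → sumℕ (λ a → P a c) ≡ n (fsuc c)) →
    (∀ a → PrefixCode K (P a)) → PrefixCode (suc K) n
  branch {K} {n} {P} n₀≡0 ΣP≡n codes = record
    { cylinders = concat (tabulate subtree)
    ; partition = λ d → ExactlyOne-concat-tabulate subtree (d fzero) (inSubtree d) (notInSubtree d)
    ; profile   = λ
      { fzero    → trans (cong length (List.filter-none _ noneAtRoot)) (sym n₀≡0)
      ; (fsuc c) → begin
          depthCount (concat (tabulate subtree)) (suc (toℕ c))  ≡⟨ depthCount-concat subtree _ ⟩
          sumℕ (λ a → depthCount (subtree a) (suc (toℕ c)))
            ≡⟨ sumℕ-cong (λ a → depthCount-lift a (cylinders (codes a)) (toℕ c)) ⟩
          sumℕ (λ a → depthCount (cylinders (codes a)) (toℕ c)) ≡⟨ sumℕ-cong (λ a → profile (codes a) c) ⟩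
          sumℕ (λ a → P a c)                                   ≡⟨ ΣP≡n c ⟩
          n (fsuc c)                                           ∎
      }
    }
    where
    open ≡-Reasoning

    subtree : Fin q → List (Cylinder (suc K))
    subtree a = map (lift a) (cylinders (codes a))

    inSubtree : ∀ d → ExactlyOne (d ∈ᶜ_) (subtree (d fzero))
    inSubtree d = ExactlyOne-map⁺ (ExactlyOne-resp
      ((λ {C} → ∈-lift⁺ {d = d} {C = C} refl) , (λ {C} → proj₂ ∘ ∈-lift⁻ {d = d} {C = C}))
      (partition (codes (d fzero)) (tail d)))

    notInSubtree : ∀ d a → a ≢ d fzero → All (∁ (d ∈ᶜ_)) (subtree a)
    notInSubtree d a a≢d₀ = All.map⁺ (All.universal
      (λ C d∈ → a≢d₀ (sym (proj₁ (∈-lift⁻ {d = d} {a} {C} d∈)))) (cylinders (codes a)))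

    noneAtRoot : All (λ C → fixed C ≢ 0) (concat (tabulate subtree))
    noneAtRoot = All.concat⁺ (All.tabulate⁺ (λ a → All.map⁺ (All.universal (λ C ()) (cylinders (codes a)))))

  -- The number of words of length K covered by cylinders with profile n.
  kraftSum : ∀ K → Profile K → ℕ
  kraftSum K n = sumℕ (λ c → n c * q ^ (K ∸ toℕ c))

  kraftSum₀ : (n : Profile 0) → kraftSum 0 n ≡ n fzero
  kraftSum₀ n = trans (ℕ.+-identityʳ _) (ℕ.*-identityʳ (n fzero))

  kraftSum-zeros : ∀ K → kraftSum K (λ _ → 0) ≡ 0
  kraftSum-zeros K = sumℕ-zeros (suc K)

  kraftSum-+ : ∀ K {p r n : Profile K} → (∀ c → p c + r c ≡ n c) →
    kraftSum K p + kraftSum K r ≡ kraftSum K n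
  kraftSum-+ K {p} {r} p+r≡n = trans (sym (sumℕ-+ (weighted p) (weighted r))) (sumℕ-cong λ c →
    trans (sym (ℕ.*-distribʳ-+ (q ^ (K ∸ toℕ c)) (p c) (r c))) (cong (_* q ^ (K ∸ toℕ c)) (p+r≡n c)))
    where
    weighted : Profile K → Fin (suc K) → ℕ
    weighted n c = n c * q ^ (K ∸ toℕ c)

  kraftSum-reverse : ∀ N (m : Fin (suc N) → ℕ) →
    kraftSum (suc N) (0 ∷ᵛ reverse m) ≡ sumℕ (λ j → m j * q ^ toℕ j)
  kraftSum-reverse N m = trans
    (sumℕ-cong λ c → cong (λ e → m (opposite c) * q ^ e) (sym (Fin.opposite-prop c)))
    (sumℕ-reverse (λ j → m j * q ^ toℕ j))

  private
    rebalance : ∀ a s c q X → (suc (a + s) + c) * (q * X) ≡ a * (q * X) + (suc s * q + c * q) * X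
    rebalance = solve-∀

    recombine : ∀ a s q X → a * (q * X) + suc s * q * X ≡ suc (a + s) * (q * X)
    recombine = solve-∀

  module _ ⦃ _ : NonZero q ⦄ where

    weightedSum≡0⇒ : ∀ {k} (f e : Fin k → ℕ) → sumℕ (λ c → f c * q ^ e c) ≡ 0 → ∀ c → f c ≡ 0
    weightedSum≡0⇒ f e Σ≡0 c = m*n≡0⇒m≡0 (f c) (q ^ e c) ⦃ m^n≢0 q (e c) ⦄ (sumℕ≡0⇒ _ Σ≡0 c)

    kraftSum≡0⇒ : ∀ K n → kraftSum K n ≡ 0 → ∀ c → n c ≡ 0
    kraftSum≡0⇒ K n = weightedSum≡0⇒ n (λ c → K ∸ toℕ c)

    kraftSum-root : ∀ K n → kraftSum K n ≡ q ^ K → n fzero ≢ 0 → n fzero ≡ 1 × (∀ c → n (fsuc c) ≡ 0)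
    kraftSum-root K n kraft n₀≢0 with m*n+o≡n⇒m≡1∧o≡0 (n fzero) ⦃ m^n≢0 q K ⦄ n₀≢0 kraft
    ... | n₀≡1 , rest≡0 = n₀≡1 , weightedSum≡0⇒ (tail n) (λ c → K ∸ suc (toℕ c)) rest≡0

    -- Greedy: take as much as possible from length 0; the shortfall is taken from the tail,
    -- where it weighs q times as much.
    extract : ∀ K j c (n : Profile K) → kraftSum K n ≡ (j + c) * q ^ K →
      ∃₂ λ (p r : Profile K) → (∀ i → p i + r i ≡ n i) × kraftSum K p ≡ j * q ^ K
    extract zero j c n kraft = (λ _ → j) , (λ _ → c) , (λ { fzero → j+c≡n₀ }) , ℕ.+-identityʳ (j * 1)
      where
      j+c≡n₀ : j + c ≡ n fzero
      j+c≡n₀ = trans (sym (ℕ.*-identityʳ (j + c))) (trans (sym kraft) (kraftSum₀ n))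
    extract (suc K) j c n kraft with j ≤? n fzero
    ... | yes j≤n₀ with m≤n⇒∃[o]m+o≡n j≤n₀
    ...   | s , j+s≡n₀ =
      (j ∷ᵛ λ _ → 0) , (s ∷ᵛ tail n) , (λ { fzero → j+s≡n₀ ; (fsuc i) → refl }) ,
      trans (cong (j * q ^ suc K +_) (kraftSum-zeros K)) (ℕ.+-identityʳ _)
    extract (suc K) j c n kraft | no j≰n₀ with m≤n⇒∃[o]m+o≡n (≰⇒> j≰n₀)
    ...   | s , refl with extract K (suc s * q) (c * q) (tail n) tailKraft
      where
      tailKraft : kraftSum K (tail n) ≡ (suc s * q + c * q) * q ^ K
      tailKraft = +-cancelˡ-≡ (n fzero * q ^ suc K) _ _ (trans kraft (rebalance (n fzero) s c q (q ^ K)))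
    ...   | p , r , p+r≡n , kraftₚ =
      (n fzero ∷ᵛ p) , (0 ∷ᵛ r) , (λ { fzero → ℕ.+-identityʳ (n fzero) ; (fsuc i) → p+r≡n i }) ,
      trans (cong (n fzero * q ^ suc K +_) kraftₚ) (recombine (n fzero) s q (q ^ K))

    splitProfile : ∀ K k (n : Profile K) → kraftSum K n ≡ k * q ^ K →
      Σ[ P ∈ (Fin k → Profile K) ] (∀ a → kraftSum K (P a) ≡ q ^ K) × (∀ c → sumℕ (λ a → P a c) ≡ n c)
    splitProfile K zero    n kraft = (λ ()) , (λ ()) , λ c → sym (kraftSum≡0⇒ K n kraft c)
    splitProfile K (suc k) n kraft with extract K 1 k n kraft
    ... | p , r , p+r≡n , kraftₚ with splitProfile K k r kraftᵣ
      where
      kraftᵣ : kraftSum K r ≡ k * q ^ K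
      kraftᵣ = +-cancelˡ-≡ (q ^ K) _ _
        (trans (cong (_+ kraftSum K r) (sym (trans kraftₚ (ℕ.*-identityˡ _))))
               (trans (kraftSum-+ K {p} {r} p+r≡n) kraft))
    ... | P , kraftP , ΣP≡r =
      (p ∷ᵛ P) , (λ { fzero → trans kraftₚ (ℕ.*-identityˡ _) ; (fsuc a) → kraftP a }) ,
      λ c → trans (cong (p c +_) (ΣP≡r c)) (p+r≡n c)

    build : ∀ K (n : Profile K) → kraftSum K n ≡ q ^ K → PrefixCode K n
    build K n kraft with n fzero ℕ.≟ 0
    ... | no n₀≢0 = trivialCode (proj₁ root) (proj₂ root)
      where root = kraftSum-root K n kraft n₀≢0
    build zero n kraft | yes n₀≡0 = ⊥-elim (ℕ.0≢1+n (trans (sym n₀≡0) (trans (sym (kraftSum₀ n)) kraft)))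
    build (suc K) n kraft | yes n₀≡0 with splitProfile K q (tail n) tailKraft
      where
      tailKraft : kraftSum K (tail n) ≡ q * q ^ K
      tailKraft = subst (λ x → x * q ^ suc K + kraftSum K (tail n) ≡ q ^ suc K) n₀≡0 kraft
    ... | P , kraftP , ΣP≡n = branch n₀≡0 ΣP≡n (λ a → build K (P a) (kraftP a))

-- Cylinders as subspaces

module CylinderSubspaces {q : ℕ} (𝔽 : FiniteField q) where
  open FiniteField 𝔽 renaming (_+_ to _⊕_; _*_ to _⊗_; refl to ≈-refl; sym to ≈-sym; trans to ≈-trans)
  open LinAlg fld
  open PrefixCodes q
  open import Relation.Binary.Reasoning.Setoid setoid
  private module Letter = Inverse (Bijection⇒Inverse card)

  δ : ∀ {e} → Fin e → Fin e → Carrier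
  δ fzero    fzero    = 1#
  δ fzero    (fsuc _) = 0#
  δ (fsuc _) fzero    = 0#
  δ (fsuc i) (fsuc j) = δ i j

  ∑-zero : ∀ {e} (f : Fin e → Carrier) → (∀ s → f s ≈ 0#) → ∑ f ≈ 0#
  ∑-zero {zero}  f f≈0 = ≈-refl
  ∑-zero {suc e} f f≈0 = ≈-trans (+-cong (f≈0 fzero) (∑-zero (tail f) (f≈0 ∘ fsuc))) (+-identityʳ 0#)

  ∑-δ : ∀ {e} (f : Fin e → Carrier) s → ∑ (λ s′ → f s′ ⊗ δ s′ s) ≈ f s
  ∑-δ f fzero    = ≈-trans (+-cong (*-identityʳ (f fzero)) (∑-zero _ (λ s′ → zeroʳ (f (fsuc s′)))))
                           (+-identityʳ _)
  ∑-δ f (fsuc s) = ≈-trans (+-cong (zeroʳ (f fzero)) (∑-δ (tail f) s)) (+-identityˡ _)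

  module _ {N} (C : Cylinder N) where

    anchor : Vect (suc N)
    anchor fzero    = 1#
    anchor (fsuc t) = [ Letter.from ∘ word C , (λ _ → 0#) ]′ (coordinate C t)

    freeUnit : Fin (free C) → Vect (suc N)
    freeUnit s fzero    = 0#
    freeUnit s (fsuc t) = [ (λ _ → 0#) , δ s ]′ (coordinate C t)

    basis : Fin (suc (free C)) → Vect (suc N)
    basis = anchor ∷ᵛ freeUnit

    lincomb-basis₀ : ∀ γ → lincomb γ basis fzero ≈ γ fzero
    lincomb-basis₀ γ = ≈-trans (+-cong (*-identityʳ _) (∑-zero _ (λ s → zeroʳ (γ (fsuc s))))) (+-identityʳ _)

    lincomb-basis : ∀ γ x →
      lincomb γ basis (fsuc (position C x)) ≈ [ (λ i → γ fzero ⊗ Letter.from (word C i)) , γ ∘ fsuc ]′ x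
    lincomb-basis γ x rewrite coordinate-position C x with x
    ... | inj₁ i = ≈-trans (+-cong ≈-refl (∑-zero _ (λ s → zeroʳ (γ (fsuc s))))) (+-identityʳ _)
    ... | inj₂ s = ≈-trans (+-cong (zeroʳ (γ fzero)) (∑-δ (γ ∘ fsuc) s)) (+-identityˡ _)

    basis-independent : LinearlyIndependent basis
    basis-independent γ γ·basis≈0 fzero    = ≈-trans (≈-sym (lincomb-basis₀ γ)) (γ·basis≈0 fzero)
    basis-independent γ γ·basis≈0 (fsuc s) =
      ≈-trans (≈-sym (lincomb-basis γ (inj₂ s))) (γ·basis≈0 (fsuc (position C (inj₂ s))))

    subspace : Subspace (suc N)
    subspace = record { dim = suc (free C) ; basis = basis ; indep = basis-independent }

    OnCylinder : Vect (suc N) → Set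
    OnCylinder v = ∀ i → v (fsuc (position C (inj₁ i))) ≈ v fzero ⊗ Letter.from (word C i)

    ∈-subspace⇔OnCylinder : ∀ v → v ∈ₛ subspace ⇔ OnCylinder v
    ∈-subspace⇔OnCylinder v = mk⇔ on-cylinder spanned
      where
      on-cylinder : v ∈ₛ subspace → OnCylinder v
      on-cylinder (γ , v≈) i = begin
        v (fsuc (position C (inj₁ i)))               ≈⟨ v≈ _ ⟩
        lincomb γ basis (fsuc (position C (inj₁ i))) ≈⟨ lincomb-basis γ (inj₁ i) ⟩
        γ fzero ⊗ Letter.from (word C i)             ≈⟨ *-congʳ (≈-sym (≈-trans (v≈ fzero) (lincomb-basis₀ γ))) ⟩
        v fzero ⊗ Letter.from (word C i)             ∎

      spanned : OnCylinder v → v ∈ₛ subspace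
      spanned on = γ , v≈
        where
        γ : Fin (suc (free C)) → Carrier
        γ = v fzero ∷ᵛ λ s → v (fsuc (position C (inj₂ s)))

        at-position : ∀ x → v (fsuc (position C x)) ≈ lincomb γ basis (fsuc (position C x))
        at-position (inj₁ i) = ≈-trans (on i) (≈-sym (lincomb-basis γ (inj₁ i)))
        at-position (inj₂ s) = ≈-sym (lincomb-basis γ (inj₂ s))

        v≈ : ∀ k → v k ≈ lincomb γ basis k
        v≈ fzero    = ≈-sym (lincomb-basis₀ γ)
        v≈ (fsuc t) = subst (λ t → v (fsuc t) ≈ lincomb γ basis (fsuc t))
                            (position-coordinate C t) (at-position (coordinate C t))

    anchor-OnCylinder : OnCylinder anchor
    anchor-OnCylinder i rewrite coordinate-position C (inj₁ i) = ≈-sym (*-identityˡ _)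

  H∞ : ∀ {N} → Hyperplane (suc N)
  H∞ = record { normal = 1# ∷ᵛ (λ _ → 0#) ; nonzero = fzero , nontrivial }

  H∞·v≈v₀ : ∀ {N} (v : Vect (suc N)) → Hyperplane.normal H∞ · v ≈ v fzero
  H∞·v≈v₀ v = ≈-trans (+-cong (*-identityˡ _) (∑-zero _ (λ t → zeroˡ (v (fsuc t))))) (+-identityʳ _)

  subspace⊈H∞ : ∀ {N} (C : Cylinder N) → ¬ (subspace C ⊆ₕ H∞)
  subspace⊈H∞ C ⊆H∞ = nontrivial (≈-trans (≈-sym (H∞·v≈v₀ (anchor C)))
    (⊆H∞ (anchor C) (Equivalence.from (∈-subspace⇔OnCylinder C (anchor C)) (anchor-OnCylinder C))))

  module _ {N} (v : Vect (suc N)) {y} (v₀y≈1 : v fzero ⊗ y ≈ 1#) where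

    normalisedWord : Fin N → Fin q
    normalisedWord t = Letter.to (y ⊗ v (fsuc t))

    private
      u≈v₀c⇔yu≈c : ∀ u c → (u ≈ v fzero ⊗ c) ⇔ (y ⊗ u ≈ c)
      u≈v₀c⇔yu≈c u c = mk⇔
        (λ u≈ → begin
          y ⊗ u               ≈⟨ *-congˡ u≈ ⟩
          y ⊗ (v fzero ⊗ c)   ≈⟨ ≈-sym (*-assoc y (v fzero) c) ⟩
          (y ⊗ v fzero) ⊗ c   ≈⟨ *-congʳ (≈-trans (*-comm y (v fzero)) v₀y≈1) ⟩
          1# ⊗ c              ≈⟨ *-identityˡ c ⟩
          c                   ∎)
        (λ yu≈ → begin
          u                   ≈⟨ ≈-sym (*-identityˡ u) ⟩
          1# ⊗ u              ≈⟨ *-congʳ (≈-sym v₀y≈1) ⟩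
          (v fzero ⊗ y) ⊗ u   ≈⟨ *-assoc (v fzero) y u ⟩
          v fzero ⊗ (y ⊗ u)   ≈⟨ *-congˡ yu≈ ⟩
          v fzero ⊗ c         ∎)

    OnCylinder⇔normalisedWord∈ᶜ : ∀ C → OnCylinder C v ⇔ normalisedWord ∈ᶜ C
    OnCylinder⇔normalisedWord∈ᶜ C = mk⇔
      (λ on i → Letter.inverseˡ (Equivalence.to (u≈v₀c⇔yu≈c _ _) (on i)))
      (λ d∈ i → Equivalence.from (u≈v₀c⇔yu≈c _ _) (≈-sym (Letter.inverseʳ (≡.sym (d∈ i)))))

  cylinderPartition : ∀ {N} {n : Profile N} → PrefixCode N n → n fzero ≡ 0 → AffineVSP (suc N)
  cylinderPartition {N} code n₀≡0 = record
    { r       = length L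
    ; U       = subspace ∘ List.lookup L
    ; dim-pos = λ _ → s≤s z≤n
    ; dim-le  = λ i → free<N (fixed≢0 i) (fixed+free (List.lookup L i))
    ; H∞      = H∞
    ; notIn   = subspace⊈H∞ ∘ List.lookup L
    ; cover   = cover
    }
    where
    L = cylinders code

    fixed≢0 : ∀ i → fixed (List.lookup L i) ≢ 0
    fixed≢0 = length-filter≡0⇒ (λ C → fixed C ℕ.≟ 0) L (≡.trans (profile code fzero) n₀≡0)

    free<N : ∀ {a b} → a ≢ 0 → a + b ≡ N → b < N
    free<N {zero}      a≢0 _     = ⊥-elim (a≢0 ≡.refl)
    free<N {suc a} {b} _   a+b≡N = subst (b <_) a+b≡N (s≤s (ℕ.m≤n+m b a))

    cover : ∀ v → ¬ (v ∈ₕ H∞) →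
      ∃[ i ] (v ∈ₛ subspace (List.lookup L i) × (∀ j → v ∈ₛ subspace (List.lookup L j) → j ≡ i))
    cover v v∉H∞ with inverse (v fzero) (v∉H∞ ∘ ≈-trans (H∞·v≈v₀ v))
    ... | y , v₀y≈1 with ExactlyOne⇒∃!-index (partition code (normalisedWord v v₀y≈1))
    ... | i , d∈ , unique =
      i , Equivalence.from (member (List.lookup L i)) d∈ ,
      λ j v∈ → unique j (Equivalence.to (member (List.lookup L j)) v∈)
      where
      member : ∀ C → v ∈ₛ subspace C ⇔ normalisedWord v v₀y≈1 ∈ᶜ C
      member C = ⇔-trans (∈-subspace⇔OnCylinder C v) (OnCylinder⇔normalisedWord∈ᶜ v v₀y≈1 C)

  count-cylinderPartition : ∀ {N} {n : Profile N} (code : PrefixCode N n) (n₀≡0 : n fzero ≡ 0) t →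
    AffineVSP.count (cylinderPartition code n₀≡0) t ≡ dimensionCount (cylinders code) t
  count-cylinderPartition code n₀≡0 t = ≡.trans
    (≡.sym (length-filter-map (λ C → suc (free C) ℕ.≟ t) (List.lookup L) (allFin (length L))))
    (cong (length ∘ filter (λ C → suc (free C) ℕ.≟ t)) (map-lookup-allFin L))
    where L = cylinders code

mainTheorem18 : (q : ℕ) → IsPrimePower q → (F : FiniteField q) → (n : ℕ) → 2 ≤ n →
    (m : Fin (n ∸ 1) → ℕ) → sumℕ (λ j → m j * q ^ toℕ j) ≡ q ^ (n ∸ 1) →
    Σ (LinAlg.AffineVSP (FiniteField.fld F) n) λ P → (∀ (j : Fin (n ∸ 1)) →
    LinAlg.AffineVSP.count P (suc (toℕ j)) ≡ m j)
mainTheorem18 zero _ F _ _ _ _ = ⊥-elim (Fin.¬Fin0 (Bijection.to (FiniteField.card F) (FiniteField.0# F)))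
mainTheorem18 q@(suc _) _ F (suc (suc N)) (s≤s (s≤s z≤n)) m kraft = affinePartition , multiplicity
  where
  open PrefixCodes q
  open CylinderSubspaces F
  open LinAlg (FiniteField.fld F) using (module AffineVSP)
  open ≡-Reasoning

  -- Dimension j + 1 means j + 1 free letters, i.e. codewords of length N - j; the empty
  -- codeword (the whole space) is excluded.
  code : PrefixCode (suc N) (0 ∷ᵛ reverse m)
  code = build (suc N) (0 ∷ᵛ reverse m) (trans (kraftSum-reverse N m) kraft)

  affinePartition = cylinderPartition code refl

  multiplicity : ∀ j → AffineVSP.count affinePartition (suc (toℕ j)) ≡ m j
  multiplicity j = begin
    AffineVSP.count affinePartition (suc (toℕ j))              ≡⟨ count-cylinderPartition code refl _ ⟩
    dimensionCount (cylinders code) (suc (toℕ j))        ≡⟨ dimensionCount≡depthCount (cylinders code) j ⟩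
    depthCount (cylinders code) (suc (toℕ (opposite j))) ≡⟨ profile code (fsuc (opposite j)) ⟩
    m (opposite (opposite j))                            ≡⟨ cong m (Fin.opposite-involutive j) ⟩
    m j                                                  ∎
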